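{- The class $\mathsf{DLBWE}$ is not $\mathcal L_\beta$-definable.
   Context: A 3-frame is $\langle W,B\rangle$ with $B\subseteq W^3$; $\#(x,y,z)$ means pairwise distinct. $\mathsf{DLBWE}$ is the class of 3-frames satisfying (B1) $B(x,y,z)\to\#(x,y,z)$; (B2) $B(x,y,z)\to B(z,y,x)$; (B3) $B(x,y,z)\to\neg B(x,z,y)$; (B4) $B(x,y,z)\wedge B(y,z,u)\to B(x,y,u)$; (B5) $B(x,y,z)\wedge B(y,u,z)\to B(x,y,u)$; (B6) $\#(x,y,z)\to B(x,y,z)\vee B(x,z,y)\vee B(y,x,z)$; (B7) $\forall y\exists x\exists z\,B(x,y,z)$; (B8) $x\neq z\to\exists y\,B(x,y,z)$. $\mathcal L_\beta$: $\varphi::=\top\mid p\mid\neg\varphi\mid\varphi\wedge\psi\mid\langle B\rangle(\varphi,\psi)$ with $w\Vdash\langle B\rangle(\varphi,\psi)$ iff there are $x,y$ with $x\Vdash\varphi$, $y\Vdash\psi$, $B(x,w,y)$. A class $K$ is $\mathcal L_\beta$-definable if there is a set $\Phi$ of $\mathcal L_\beta$-formulas with $\mathfrak F\in K$ iff all of $\Phi$ is valid on $\mathfrak F$, for every 3-frame $\mathfrak F$. -}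

module Defs where

open import Data.Nat using (ℕ)
open import Data.Product using (Σ; _×_; _,_; ∃; ∃-syntax)
open import Data.Sum using (_⊎_)
open import Data.Unit using (⊤)
open import Relation.Nullary using (¬_)
open import Relation.Binary.PropositionalEquality using (_≡_; _≢_)
open import Level using (Level; _⊔_) renaming (suc to lsuc; zero to lzero)

record Frame : Set₁ where
  field
    W : Set
    B : W → W → W → Set

module _ (F : Frame) where
  open Frame F

  Distinct : W → W → W → Set
  Distinct x y z = x ≢ y × y ≢ z × x ≢ z

  B1 B2 B3 B4 B5 B6 B7 B8 : Set
  B1 = ∀ x y z → B x y z → Distinct x y z
  B2 = ∀ x y z → B x y z → B z y x
  B3 = ∀ x y z → B x y z → ¬ B x z y
  B4 = ∀ x y z u → B x y z → B y z u → B x y u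
  B5 = ∀ x y z u → B x y z → B y u z → B x y u
  B6 = ∀ x y z → Distinct x y z → B x y z ⊎ B x z y ⊎ B y x z
  B7 = ∀ y → ∃[ x ] ∃[ z ] B x y z
  B8 = ∀ x z → x ≢ z → ∃[ y ] B x y z

  DLBWE : Set
  DLBWE = B1 × B2 × B3 × B4 × B5 × B6 × B7 × B8

data Formula : Set where
  ⊤f   : Formula
  var  : ℕ → Formula
  ¬f_  : Formula → Formula
  _∧f_ : Formula → Formula → Formula
  ⟨B⟩  : Formula → Formula → Formula

Valuation : Frame → Set₁
Valuation F = ℕ → Frame.W F → Set

_,_⊩_at_ : (F : Frame) → Valuation F → Formula → Frame.W F → Set
F , V ⊩ ⊤f at w = ⊤
F , V ⊩ var n at w = V n w
F , V ⊩ (¬f φ) at w = ¬ (F , V ⊩ φ at w)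
F , V ⊩ (φ ∧f ψ) at w = (F , V ⊩ φ at w) × (F , V ⊩ ψ at w)
F , V ⊩ ⟨B⟩ φ ψ at w =
  ∃[ x ] ∃[ y ] ((F , V ⊩ φ at x) × (F , V ⊩ ψ at y) × Frame.B F x w y)

Valid : Frame → Formula → Set₁
Valid F φ = (V : Valuation F) → (w : Frame.W F) → F , V ⊩ φ at w

Definable : (Frame → Set) → Set₁
Definable K =
  Σ (Formula → Set) λ Φ → (F : Frame) →
    (K F → (∀ φ → Φ φ → Valid F φ)) × ((∀ φ → Φ φ → Valid F φ) → K F)

{-# OPTIONS --safe #-}
module Submission where

open import Defs
open import Relation.Nullary using (¬_)
open import Data.Empty using (⊥; ⊥-elim)
open import Data.Product using (_×_; _,_; ∃-syntax; proj₁; proj₂)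
open import Data.Product.Function.NonDependent.Propositional using (_×-⇔_)
open import Data.Rational as ℚ using (0ℚ; 1ℚ; _+_; _-_)
open import Data.Rational.Properties as ℚ using (<-isDenseLinearOrder)
open import Data.Sum using (_⊎_; inj₁; inj₂)
open import Function using (_∘_; id; _⇔_; mk⇔; Equivalence)
open import Function.Related.TypeIsomorphisms using (¬-cong-⇔)
open import Level using (0ℓ)
open import Relation.Binary using (Rel; Trichotomous; tri<; tri≈; tri>; Dense)
open import Relation.Binary.Structures using (IsStrictPartialOrder; IsDenseLinearOrder)
open import Relation.Binary.PropositionalEquality using (_≡_; refl; subst)

-- Truth of L_β-formulas is invariant under bounded morphisms, and both
-- injections into a disjoint union are bounded morphisms, so a disjoint union
-- validates every formula valid on both summands. The betweenness frame of ℚ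
-- is in DLBWE, but the disjoint union of two copies of it violates B8: no
-- point lies between points of different copies.

open Frame
open Equivalence using (to; from)

variable
  F G : Frame

Between : {A : Set} → Rel A 0ℓ → A → A → A → Set
Between _<_ x y z = (x < y × y < z) ⊎ (z < y × y < x)

betweenness : {A : Set} → Rel A 0ℓ → Frame
betweenness {A} _<_ = record { W = A ; B = Between _<_ }

module _ {A : Set} {_<_ : Rel A 0ℓ} (spo : IsStrictPartialOrder _≡_ _<_) where
  open IsStrictPartialOrder spo using (irrefl; trans; asym)

  private
    <⇒≢ : ∀ {x y} → x < y → ¬ x ≡ y
    <⇒≢ x<y refl = irrefl refl x<y

    >⇒≢ : ∀ {x y} → y < x → ¬ x ≡ y
    >⇒≢ y<x refl = irrefl refl y<x

    no-3-cycle : ∀ {x y z} → x < y → y < z → ¬ z < x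
    no-3-cycle x<y y<z = asym (trans x<y y<z)

  between-B1 : B1 (betweenness _<_)
  between-B1 x y z (inj₁ (x<y , y<z)) = <⇒≢ x<y , <⇒≢ y<z , <⇒≢ (trans x<y y<z)
  between-B1 x y z (inj₂ (z<y , y<x)) = >⇒≢ y<x , >⇒≢ z<y , >⇒≢ (trans z<y y<x)

  between-B2 : B2 (betweenness _<_)
  between-B2 x y z (inj₁ p) = inj₂ p
  between-B2 x y z (inj₂ p) = inj₁ p

  between-B3 : B3 (betweenness _<_)
  between-B3 x y z (inj₁ (_ , y<z))   (inj₁ (_ , z<y))   = asym y<z z<y
  between-B3 x y z (inj₁ (x<y , y<z)) (inj₂ (_ , z<x))   = no-3-cycle x<y y<z z<x
  between-B3 x y z (inj₂ (z<y , y<x)) (inj₁ (x<z , _))   = no-3-cycle z<y y<x x<z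
  between-B3 x y z (inj₂ (z<y , _))   (inj₂ (y<z , _))   = asym z<y y<z

  between-B4 : B4 (betweenness _<_)
  between-B4 x y z u (inj₁ (x<y , _))   (inj₁ (y<z , z<u)) = inj₁ (x<y , trans y<z z<u)
  between-B4 x y z u (inj₁ (_ , y<z))   (inj₂ (_ , z<y))   = ⊥-elim (asym y<z z<y)
  between-B4 x y z u (inj₂ (z<y , _))   (inj₁ (y<z , _))   = ⊥-elim (asym z<y y<z)
  between-B4 x y z u (inj₂ (_ , y<x))   (inj₂ (u<z , z<y)) = inj₂ (trans u<z z<y , y<x)

  between-B5 : B5 (betweenness _<_)
  between-B5 x y z u (inj₁ (x<y , _))   (inj₁ (y<u , _))   = inj₁ (x<y , y<u)
  between-B5 x y z u (inj₁ (_ , y<z))   (inj₂ (z<u , u<y)) = ⊥-elim (asym y<z (trans z<u u<y))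
  between-B5 x y z u (inj₂ (z<y , _))   (inj₁ (y<u , u<z)) = ⊥-elim (asym z<y (trans y<u u<z))
  between-B5 x y z u (inj₂ (_ , y<x))   (inj₂ (_ , u<y))   = inj₂ (u<y , y<x)

between-B6 : {A : Set} {_<_ : Rel A 0ℓ} → Trichotomous _≡_ _<_ → B6 (betweenness _<_)
between-B6 compare x y z (x≢y , y≢z , x≢z) with compare x y | compare y z
... | tri≈ _ x≡y _ | _              = ⊥-elim (x≢y x≡y)
... | _            | tri≈ _ y≡z _   = ⊥-elim (y≢z y≡z)
... | tri< x<y _ _ | tri< y<z _ _   = inj₁ (inj₁ (x<y , y<z))
... | tri> _ _ y<x | tri> _ _ z<y   = inj₁ (inj₂ (z<y , y<x))
... | tri< x<y _ _ | tri> _ _ z<y with compare x z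
...   | tri< x<z _ _ = inj₂ (inj₁ (inj₁ (x<z , z<y)))
...   | tri≈ _ x≡z _ = ⊥-elim (x≢z x≡z)
...   | tri> _ _ z<x = inj₂ (inj₂ (inj₂ (z<x , x<y)))
between-B6 compare x y z (x≢y , y≢z , x≢z)
    | tri> _ _ y<x | tri< y<z _ _ with compare x z
...   | tri< x<z _ _ = inj₂ (inj₂ (inj₁ (y<x , x<z)))
...   | tri≈ _ x≡z _ = ⊥-elim (x≢z x≡z)
...   | tri> _ _ z<x = inj₂ (inj₁ (inj₂ (y<z , z<x)))

between-B7 : {A : Set} {_<_ : Rel A 0ℓ} →
             (∀ y → ∃[ x ] x < y) → (∀ y → ∃[ z ] y < z) → B7 (betweenness _<_)
between-B7 below above y with below y | above y
... | x , x<y | z , y<z = x , z , inj₁ (x<y , y<z)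

between-B8 : {A : Set} {_<_ : Rel A 0ℓ} →
             Trichotomous _≡_ _<_ → Dense _<_ → B8 (betweenness _<_)
between-B8 compare dense x z x≢z with compare x z
... | tri< x<z _ _ = let y , x<y , y<z = dense x<z in y , inj₁ (x<y , y<z)
... | tri≈ _ x≡z _ = ⊥-elim (x≢z x≡z)
... | tri> _ _ z<x = let y , z<y , y<x = dense z<x in y , inj₂ (z<y , y<x)

between-DLBWE : {A : Set} {_<_ : Rel A 0ℓ} → IsDenseLinearOrder _≡_ _<_ →
                (∀ y → ∃[ x ] x < y) → (∀ y → ∃[ z ] y < z) →
                DLBWE (betweenness _<_)
between-DLBWE dlo below above =
    between-B1 isStrictPartialOrder , between-B2 isStrictPartialOrder
  , between-B3 isStrictPartialOrder , between-B4 isStrictPartialOrder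
  , between-B5 isStrictPartialOrder , between-B6 compare
  , between-B7 below above , between-B8 compare dense
  where open IsDenseLinearOrder dlo using (isStrictPartialOrder; compare; dense)

_⊎ᶠ_ : Frame → Frame → Frame
F ⊎ᶠ G = record { W = W F ⊎ W G ; B = B⊎ }
  where
  B⊎ : W F ⊎ W G → W F ⊎ W G → W F ⊎ W G → Set
  B⊎ (inj₁ x) (inj₁ y) (inj₁ z) = B F x y z
  B⊎ (inj₂ x) (inj₂ y) (inj₂ z) = B G x y z
  B⊎ _        _        _        = ⊥

⊎ᶠ-¬B8 : W F → W G → ¬ B8 (F ⊎ᶠ G)
⊎ᶠ-¬B8 a b b8 with b8 (inj₁ a) (inj₂ b) (λ ())
... | inj₁ _ , ()
... | inj₂ _ , ()

record IsBoundedMorphism (F G : Frame) (f : W F → W G) : Set where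
  field
    forth : ∀ {x w y} → B F x w y → B G (f x) (f w) (f y)
    back  : ∀ {x′ w y′} → B G x′ (f w) y′ →
            ∃[ x ] ∃[ y ] x′ ≡ f x × y′ ≡ f y × B F x w y

module _ {f : W F → W G} (bm : IsBoundedMorphism F G f) (V : Valuation G) where
  open IsBoundedMorphism bm

  ⊩-boundedMorphism : ∀ φ w → (G , V ⊩ φ at f w) ⇔ (F , (λ n → V n ∘ f) ⊩ φ at w)
  ⊩-boundedMorphism ⊤f       w = mk⇔ id id
  ⊩-boundedMorphism (var n)  w = mk⇔ id id
  ⊩-boundedMorphism (¬f φ)   w = ¬-cong-⇔ (⊩-boundedMorphism φ w)
  ⊩-boundedMorphism (φ ∧f ψ) w = ⊩-boundedMorphism φ w ×-⇔ ⊩-boundedMorphism ψ w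
  ⊩-boundedMorphism (⟨B⟩ φ ψ) w = mk⇔ reflect preserve
    where
    reflect : G , V ⊩ ⟨B⟩ φ ψ at f w → F , (λ n → V n ∘ f) ⊩ ⟨B⟩ φ ψ at w
    reflect (_ , _ , x′⊩φ , y′⊩ψ , b) with back b
    ... | x , y , refl , refl , b′ =
      x , y , to (⊩-boundedMorphism φ x) x′⊩φ , to (⊩-boundedMorphism ψ y) y′⊩ψ , b′

    preserve : F , (λ n → V n ∘ f) ⊩ ⟨B⟩ φ ψ at w → G , V ⊩ ⟨B⟩ φ ψ at f w
    preserve (x , y , x⊩φ , y⊩ψ , b) =
      f x , f y , from (⊩-boundedMorphism φ x) x⊩φ
                , from (⊩-boundedMorphism ψ y) y⊩ψ , forth b

module _ {F G : Frame} where

  inj₁-isBoundedMorphism : IsBoundedMorphism F (F ⊎ᶠ G) inj₁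
  inj₁-isBoundedMorphism = record { forth = id ; back = back }
    where
    back : ∀ {x′ w y′} → B (F ⊎ᶠ G) x′ (inj₁ w) y′ →
           ∃[ x ] ∃[ y ] x′ ≡ inj₁ x × y′ ≡ inj₁ y × B F x w y
    back {inj₁ x} {y′ = inj₁ y} b = x , y , refl , refl , b

  inj₂-isBoundedMorphism : IsBoundedMorphism G (F ⊎ᶠ G) inj₂
  inj₂-isBoundedMorphism = record { forth = id ; back = back }
    where
    back : ∀ {x′ w y′} → B (F ⊎ᶠ G) x′ (inj₂ w) y′ →
           ∃[ x ] ∃[ y ] x′ ≡ inj₂ x × y′ ≡ inj₂ y × B G x w y
    back {inj₂ x} {y′ = inj₂ y} b = x , y , refl , refl , b

  valid-⊎ᶠ : ∀ φ → Valid F φ → Valid G φ → Valid (F ⊎ᶠ G) φ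
  valid-⊎ᶠ φ F⊨φ G⊨φ V (inj₁ w) =
    from (⊩-boundedMorphism inj₁-isBoundedMorphism V φ w) (F⊨φ _ w)
  valid-⊎ᶠ φ F⊨φ G⊨φ V (inj₂ w) =
    from (⊩-boundedMorphism inj₂-isBoundedMorphism V φ w) (G⊨φ _ w)

  definable⇒⊎ᶠ-closed : ∀ {K} → Definable K → K F → K G → K (F ⊎ᶠ G)
  definable⇒⊎ᶠ-closed (Φ , defines) F∈K G∈K =
    proj₂ (defines (F ⊎ᶠ G)) λ φ φ∈Φ →
      valid-⊎ᶠ φ (proj₁ (defines F) F∈K φ φ∈Φ) (proj₁ (defines G) G∈K φ φ∈Φ)

DLBWE⇒B8 : DLBWE F → B8 F
DLBWE⇒B8 (_ , _ , _ , _ , _ , _ , _ , b8) = b8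

ℚ-DLBWE : DLBWE (betweenness ℚ._<_)
ℚ-DLBWE = between-DLBWE <-isDenseLinearOrder below above
  where
  below : ∀ q → ∃[ p ] p ℚ.< q
  below q = q - 1ℚ ,
    subst (q - 1ℚ ℚ.<_) (ℚ.+-identityʳ q) (ℚ.+-monoʳ-< q (ℚ.negative⁻¹ (ℚ.- 1ℚ)))
  above : ∀ q → ∃[ r ] q ℚ.< r
  above q = q + 1ℚ ,
    subst (ℚ._< q + 1ℚ) (ℚ.+-identityʳ q) (ℚ.+-monoʳ-< q (ℚ.positive⁻¹ 1ℚ))

corollary4p16 : ¬ Definable DLBWE
corollary4p16 definable =
  ⊎ᶠ-¬B8 0ℚ 0ℚ (DLBWE⇒B8 (definable⇒⊎ᶠ-closed definable ℚ-DLBWE ℚ-DLBWE))
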